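{- Let $m,n\geq 3$ be integers and let $C_k$ denote the cycle on $k$ vertices. Then: (1) $\chi_{i}(C_{m}\times C_{n})=4$ if $m\equiv n\equiv 0 \pmod 4$; (2) $\chi_{i}(C_{m}\times C_{n})=5$ if either $m\neq 6$ is even and $n\geq5$ is odd, or both $m,n\geq5$ are odd, or $(m,n)=(4s+2,4t+2)$ with $s,t\geq2$, or $(m,n)=(4,4t+2)$ with $t\geq2$; (3) $\chi_{i}(C_{m}\times C_{n})=6$ if $m=4s$ for some $s\geq1$ and $n\in\{3,6\}$; (4) $\chi_{i}(C_{m}\times C_{n})=7$ if $m\in\{3,6\}$ and $n=2t+1$ with $t\geq3$; (5) $\chi_{i}(C_{m}\times C_{n})=8$ if $m\in\{3,6\}$ and $n=5$; (6) $\chi_{i}(C_{m}\times C_{n})=9$ if $m\in\{3,6\}$ and $n=3$.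
   Context: All graphs are finite and simple. An injective $k$-coloring of a graph $G$ is a function $f:V(G)\to\{1,\dots,k\}$ such that no vertex is adjacent to two distinct vertices $u,w$ with $f(u)=f(w)$. The injective chromatic number $\chi_i(G)$ is the minimum $k$ for which $G$ admits an injective $k$-coloring. The direct product $G\times H$ has vertex set $V(G)\times V(H)$, with $(g,h)(g',h')$ an edge iff $gg'\in E(G)$ and $hh'\in E(H)$. (Since $C_m\times C_n\cong C_n\times C_m$, the listed cases also determine the values for the pairs with roles of $m$ and $n$ exchanged.) -}

module Defs where

open import Data.Nat using (ℕ; suc; _≤_)
open import Data.Fin using (Fin; toℕ)
open import Data.Product using (Σ; _×_; _,_)
open import Data.Sum using (_⊎_)
open import Relation.Binary.PropositionalEquality using (_≡_)

record Graph : Set₁ where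
  field
    V   : Set
    Adj : V → V → Set
open Graph public

CycSucc : (k : ℕ) → Fin k → Fin k → Set
CycSucc k i j = (toℕ j ≡ suc (toℕ i)) ⊎ (suc (toℕ i) ≡ k × toℕ j ≡ 0)

-- (For k ≥ 3 this is the simple cycle graph on k vertices.)
Cycle : ℕ → Graph
Cycle k = record
  { V   = Fin k
  ; Adj = λ i j → CycSucc k i j ⊎ CycSucc k j i
  }

_×ᵍ_ : Graph → Graph → Graph
G ×ᵍ H = record
  { V   = V G × V H
  ; Adj = λ { (g , h) (g' , h') → Adj G g g' × Adj H h h' }
  }

IsInjectiveColoring : (G : Graph) (k : ℕ) → (V G → Fin k) → Set
IsInjectiveColoring G k f =
  ∀ (v u w : V G) → Adj G v u → Adj G v w → f u ≡ f w → u ≡ w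

InjChromaticNumber : Graph → ℕ → Set
InjChromaticNumber G k =
  (Σ (V G → Fin k) (IsInjectiveColoring G k))
  × (∀ (j : ℕ) (f : V G → Fin j) → IsInjectiveColoring G j f → k ≤ j)

{-# OPTIONS --safe #-}
module Submission where

-- Upper bounds: the colourings have the form (i , j) ↦ φ (α i) (β j), where α and β map the
-- distance-two graphs of the cycles (i − 1 ~ i + 1) into small target graphs (distinct colours,
-- C_5, or Kneser graphs of 3-sets); such maps are obtained by pumping short words checked by
-- computation.  Lower bounds: vertices that pairwise share a neighbour get distinct colours, and
-- products of such sets ({i − 1, i + 1}, or three vertices when m ∈ {3, 6}) give 4, 6 and 9.
-- A colouring with exactly 4 or 6 colours would make the distance-two graph of C_n bipartite,
-- forcing 4 ∣ n; and 7 colours on C_m × C_5 would map C_5 into the Kneser graph K(7,3).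

open import Defs
open import Data.Nat using (ℕ; _+_; _*_; _≤_)
open import Data.Nat.Divisibility using (_∣_)
open import Data.Product using (_×_; ∃-syntax)
open import Data.Sum using (_⊎_)
open import Relation.Binary.PropositionalEquality using (_≡_; _≢_)
open import Relation.Nullary using (¬_)

open import Data.Nat using (zero; suc; _∸_; _<_; z≤n; s≤s; _%_; _/_)
import Data.Nat as ℕ
import Data.Nat.Properties as ℕₚ
open import Data.Nat.DivMod using (_mod_; m≡m%n+[m/n]*n; m%n<n)
open import Data.Nat.Divisibility using (divides; ∣-trans; ∣m+n∣m⇒∣n; ∣⇒≤)
open import Data.Fin using (Fin; toℕ; fromℕ<; #_; combine; remQuot; punchOut)
import Data.Fin as Fin
import Data.Fin.Properties as Finₚ
open import Data.Fin.Properties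
  using ( toℕ-fromℕ<; toℕ-injective; toℕ<n; all?; any?; injective⇒≤
        ; combine-remQuot; combine-injective; punchOut-injective)
open import Data.Vec using (Vec; []; _∷_; lookup)
open import Data.Bool using (Bool; true; false; not)
open import Data.Bool.Properties using (not-¬; ¬-not; not-involutive)
open import Data.Empty using (⊥; ⊥-elim)
open import Data.Product using (Σ; ∃; _,_; proj₁; proj₂; uncurry)
open import Data.Product.Properties using (,-injective; ×-≡,≡→≡)
open import Data.Sum using (inj₁; inj₂; [_,_]; swap; map)
open import Function using (_∘_)
open import Function.Definitions using (Injective)
open import Relation.Nullary using (Dec; does; yes; no)
open import Relation.Nullary.Decidable using (True; toWitness; dec-true; ¬?; _×-dec_; _⊎-dec_; _→-dec_; map′)
open import Relation.Binary.Definitions using (Decidable; tri<; tri≈; tri>)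
open import Relation.Binary.PropositionalEquality
  using (refl; sym; trans; cong; subst; subst₂; ≢-sym; module ≡-Reasoning)

sucMod : ℕ → ℕ → ℕ
sucMod k x with suc x ℕ.≟ k
... | yes _ = 0
... | no _  = suc x

predMod : ℕ → ℕ → ℕ
predMod k zero    = k ∸ 1
predMod k (suc x) = x

sucMod-< : ∀ {k x} → suc x < k → sucMod k x ≡ suc x
sucMod-< {k} {x} lt with suc x ℕ.≟ k
... | yes refl = ⊥-elim (ℕₚ.<-irrefl refl lt)
... | no _     = refl

sucMod-last : ∀ k → sucMod (suc k) k ≡ 0
sucMod-last k with suc k ℕ.≟ suc k
... | yes _ = refl
... | no ¬refl = ⊥-elim (¬refl refl)

sucMod<k : ∀ {k x} → x < k → sucMod k x < k
sucMod<k {k} {x} x<k with suc x ℕ.≟ k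
... | yes _ = ℕₚ.≤-trans (s≤s z≤n) x<k
... | no ¬wraps = ℕₚ.≤∧≢⇒< x<k ¬wraps

predMod<k : ∀ {k x} → x < k → predMod k x < k
predMod<k {suc k} {zero}  _   = ℕₚ.n<1+n k
predMod<k {x = suc x}     x<k = ℕₚ.<-trans (ℕₚ.n<1+n x) x<k

predMod-sucMod : ∀ {k x} → x < k → predMod k (sucMod k x) ≡ x
predMod-sucMod {k} {x} _ with suc x ℕ.≟ k
... | yes refl = refl
... | no _     = refl

sucMod-predMod : ∀ {k x} → x < k → sucMod k (predMod k x) ≡ x
sucMod-predMod {suc k} {zero}  _   = sucMod-last k
sucMod-predMod {x = suc x}     x<k = sucMod-< x<k

next prev : ∀ {k} → Fin k → Fin k
next i = fromℕ< (sucMod<k (toℕ<n i))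
prev i = fromℕ< (predMod<k (toℕ<n i))

toℕ-next : ∀ {k} (i : Fin k) → toℕ (next i) ≡ sucMod k (toℕ i)
toℕ-next i = toℕ-fromℕ< _

toℕ-prev : ∀ {k} (i : Fin k) → toℕ (prev i) ≡ predMod k (toℕ i)
toℕ-prev i = toℕ-fromℕ< _

prev-next : ∀ {k} (i : Fin k) → prev (next i) ≡ i
prev-next {k} i = toℕ-injective (begin
  toℕ (prev (next i))           ≡⟨ toℕ-prev (next i) ⟩
  predMod k (toℕ (next i))      ≡⟨ cong (predMod k) (toℕ-next i) ⟩
  predMod k (sucMod k (toℕ i))  ≡⟨ predMod-sucMod (toℕ<n i) ⟩
  toℕ i                         ∎)
  where open ≡-Reasoning

next-prev : ∀ {k} (i : Fin k) → next (prev i) ≡ i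
next-prev {k} i = toℕ-injective (begin
  toℕ (next (prev i))           ≡⟨ toℕ-next (prev i) ⟩
  sucMod k (toℕ (prev i))       ≡⟨ cong (sucMod k) (toℕ-prev i) ⟩
  sucMod k (predMod k (toℕ i))  ≡⟨ sucMod-predMod (toℕ<n i) ⟩
  toℕ i                         ∎)
  where open ≡-Reasoning

cycSucc-next : ∀ {k} (i : Fin k) → CycSucc k i (next i)
cycSucc-next {k} i = from-sucMod (toℕ-next i)
  where
  from-sucMod : toℕ (next i) ≡ sucMod k (toℕ i) → CycSucc k i (next i)
  from-sucMod e with suc (toℕ i) ℕ.≟ k
  ... | yes wraps = inj₂ (wraps , e)
  ... | no _      = inj₁ e

cycSucc⇒next : ∀ {k} {i j : Fin k} → CycSucc k i j → j ≡ next i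
cycSucc⇒next {k} {i} {j} c = toℕ-injective (trans (to-sucMod c) (sym (toℕ-next i)))
  where
  to-sucMod : CycSucc k i j → toℕ j ≡ sucMod k (toℕ i)
  to-sucMod c with suc (toℕ i) ℕ.≟ k
  to-sucMod (inj₁ e)          | yes wraps = ⊥-elim (ℕₚ.<-irrefl (trans e wraps) (toℕ<n j))
  to-sucMod (inj₂ (_ , e))    | yes _    = e
  to-sucMod (inj₁ e)          | no _     = e
  to-sucMod (inj₂ (wraps , _)) | no ¬wraps = ⊥-elim (¬wraps wraps)

next-adj : ∀ {k} (i : Fin k) → Adj (Cycle k) i (next i)
next-adj i = inj₁ (cycSucc-next i)

prev-adj : ∀ {k} (i : Fin k) → Adj (Cycle k) i (prev i)
prev-adj {k} i = inj₂ (subst (CycSucc k (prev i)) (next-prev i) (cycSucc-next (prev i)))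

step : ∀ {k} → Bool → Fin k → Fin k
step true  = next
step false = prev

adj⇒step : ∀ {k} {i j : Fin k} → Adj (Cycle k) i j → ∃ λ s → j ≡ step s i
adj⇒step (inj₁ c) = true , cycSucc⇒next c
adj⇒step {i = i} {j} (inj₂ c) = false , trans (sym (prev-next j)) (cong prev (sym (cycSucc⇒next c)))

sucMod≢predMod : ∀ {k x} → 3 ≤ k → x < k → sucMod k x ≢ predMod k x
sucMod≢predMod {k} {x} k≥3 x<k eq with suc x ℕ.≟ k
sucMod≢predMod {x = zero}        (s≤s ())              _ _  | yes refl
sucMod≢predMod {x = suc zero}    (s≤s (s≤s ()))        _ _  | yes refl
sucMod≢predMod {x = suc (suc x)} _                     _ () | yes refl
sucMod≢predMod {x = zero}        (s≤s (s≤s (s≤s _)))   _ () | no _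
sucMod≢predMod {x = suc x}       _                     _ eq | no _ =
  ℕₚ.m≢1+m+n x {1} (trans (sym eq) (cong suc (ℕₚ.+-comm 1 x)))

next≢prev : ∀ {k} → 3 ≤ k → (i : Fin k) → next i ≢ prev i
next≢prev {k} k≥3 i eq =
  sucMod≢predMod k≥3 (toℕ<n i) (trans (sym (toℕ-next i)) (trans (cong toℕ eq) (toℕ-prev i)))

InjColoring : Graph → ℕ → Set
InjColoring G k = Σ (V G → Fin k) (IsInjectiveColoring G k)

-- α is a homomorphism to R from the distance-two graph of C_k, in which i − 1 ~ i + 1.
Dist2Hom : ∀ {A : Set} {k} → (A → A → Set) → (Fin k → A) → Set
Dist2Hom R α = ∀ i → R (α (prev i)) (α (next i))

Distinct₄ : ∀ {A : Set} → A → A → A → A → Set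
Distinct₄ w x y z = (w ≢ x) × (w ≢ y) × (w ≢ z) × (x ≢ y) × (x ≢ z) × (y ≢ z)

distinct₄⇒injective : ∀ {A : Set} (g : Bool → Bool → A) →
  Distinct₄ (g true true) (g true false) (g false true) (g false false) →
  ∀ {s t s′ t′} → g s t ≡ g s′ t′ → s ≡ s′ × t ≡ t′
distinct₄⇒injective g (d₁ , d₂ , d₃ , d₄ , d₅ , d₆) = go
  where
  go : ∀ {s t s′ t′} → g s t ≡ g s′ t′ → s ≡ s′ × t ≡ t′
  go {true}  {true}  {true}  {true}  e = refl , refl
  go {true}  {true}  {true}  {false} e = ⊥-elim (d₁ e)
  go {true}  {true}  {false} {true}  e = ⊥-elim (d₂ e)
  go {true}  {true}  {false} {false} e = ⊥-elim (d₃ e)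
  go {true}  {false} {true}  {true}  e = ⊥-elim (d₁ (sym e))
  go {true}  {false} {true}  {false} e = refl , refl
  go {true}  {false} {false} {true}  e = ⊥-elim (d₄ e)
  go {true}  {false} {false} {false} e = ⊥-elim (d₅ e)
  go {false} {true}  {true}  {true}  e = ⊥-elim (d₂ (sym e))
  go {false} {true}  {true}  {false} e = ⊥-elim (d₄ (sym e))
  go {false} {true}  {false} {true}  e = refl , refl
  go {false} {true}  {false} {false} e = ⊥-elim (d₆ e)
  go {false} {false} {true}  {true}  e = ⊥-elim (d₃ (sym e))
  go {false} {false} {true}  {false} e = ⊥-elim (d₅ (sym e))
  go {false} {false} {false} {true}  e = ⊥-elim (d₆ (sym e))
  go {false} {false} {false} {false} e = refl , refl

-- The neighbours of (i , j) are (step s i , step t j), so the colouring is injective as soon as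
-- the four colours φ (α (i ± 1)) (β (j ± 1)) are distinct.
product-coloring : ∀ {A B : Set} {m n K} (R : A → A → Set) (S : B → B → Set) (φ : A → B → Fin K) →
  (∀ {a₀ a₁ b₀ b₁} → R a₀ a₁ → S b₀ b₁ →
     Distinct₄ (φ a₁ b₁) (φ a₁ b₀) (φ a₀ b₁) (φ a₀ b₀)) →
  (α : Fin m → A) → Dist2Hom R α → (β : Fin n → B) → Dist2Hom S β →
  IsInjectiveColoring (Cycle m ×ᵍ Cycle n) K (λ v → φ (α (proj₁ v)) (β (proj₂ v)))
product-coloring R S φ spread α α-hom β β-hom (i , j) _ _ (iu , jv) (iu′ , jv′) eq
  with adj⇒step iu | adj⇒step jv | adj⇒step iu′ | adj⇒step jv′
... | s , refl | t , refl | s′ , refl | t′ , refl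
  with distinct₄⇒injective (λ s t → φ (α (step s i)) (β (step t j))) (spread (α-hom i) (β-hom j))
         {s} {t} {s′} {t′} eq
... | refl , refl = refl

Disjoint : ∀ {p K} → (Fin p → Fin K) → (Fin p → Fin K) → Set
Disjoint x y = ∀ a a′ → x a ≢ y a′

Apart : ∀ {p K} → (Fin p → Fin K) → (Fin p → Fin K) → Set
Apart x y = Injective _≡_ _≡_ x × Injective _≡_ _≡_ y × Disjoint x y

row-coloring : ∀ {m n p K} (α : Fin m → Fin p) → Dist2Hom _≢_ α →
  (β : Fin n → Fin p → Fin K) → Dist2Hom Apart β → InjColoring (Cycle m ×ᵍ Cycle n) K
row-coloring α α-hom β β-hom = _ , product-coloring _≢_ Apart (λ a y → y a) spread α α-hom β β-hom
  where
  spread : ∀ {a₀ a₁ y₀ y₁} → a₀ ≢ a₁ → Apart y₀ y₁ → Distinct₄ (y₁ a₁) (y₀ a₁) (y₁ a₀) (y₀ a₀)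
  spread {a₀} {a₁} a₀≢a₁ (y₀-inj , y₁-inj , disj) =
      (λ e → disj a₁ a₁ (sym e))
    , (λ e → a₀≢a₁ (sym (y₁-inj e)))
    , (λ e → disj a₀ a₁ (sym e))
    , disj a₁ a₀
    , (λ e → a₀≢a₁ (sym (y₀-inj e)))
    , (λ e → disj a₀ a₀ (sym e))

grid-coloring : ∀ {m n p q} → Σ (Fin m → Fin p) (Dist2Hom _≢_) → Σ (Fin n → Fin q) (Dist2Hom _≢_) →
  InjColoring (Cycle m ×ᵍ Cycle n) (p * q)
grid-coloring (α , α-hom) (β , β-hom) = row-coloring α α-hom (λ j a → combine a (β j)) apart
  where
  apart : ∀ j → Apart (λ a → combine a (β (prev j))) (λ a → combine a (β (next j)))
  apart j = (λ e → proj₁ (combine-injective _ _ _ _ e))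
          , (λ e → proj₁ (combine-injective _ _ _ _ e))
          , λ a a′ e → β-hom j (proj₂ (combine-injective a _ a′ _ e))

dist2Hom-fromℕ : ∀ {A : Set} {k} (R : A → A → Set) (g : ℕ → A) → 3 ≤ k →
  (∀ x → 2 + x < k → R (g x) (g (2 + x))) → R (g (k ∸ 1)) (g 1) → R (g (k ∸ 2)) (g 0) →
  Dist2Hom R (λ (i : Fin k) → g (toℕ i))
dist2Hom-fromℕ {k = k} R g k≥3 interior wrap₁ wrap₀ i
  rewrite toℕ-prev i | toℕ-next i = at (toℕ i) (toℕ<n i)
  where
  at : ∀ x → x < k → R (g (predMod k x)) (g (sucMod k x))
  at zero _ rewrite sucMod-< {k} {0} (ℕₚ.≤-trans (s≤s (s≤s z≤n)) k≥3) = wrap₁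
  at (suc x) x<k with suc (suc x) ℕ.≟ k
  ... | yes wraps = subst (λ z → R (g (z ∸ 2)) (g 0)) (sym wraps) wrap₀
  ... | no ¬wraps = interior x (ℕₚ.≤∧≢⇒< x<k ¬wraps)

pump : ∀ {A : Set} → (ℕ → A) → ℕ → ℕ → A
pump Y zero    x                          = Y x
pump Y (suc r) 0                          = Y 0
pump Y (suc r) 1                          = Y 1
pump Y (suc r) 2                          = Y 2
pump Y (suc r) 3                          = Y 3
pump Y (suc r) (suc (suc (suc (suc x)))) = pump Y r x

pump-0 : ∀ {A : Set} (Y : ℕ → A) r → pump Y r 0 ≡ Y 0
pump-0 Y zero    = refl
pump-0 Y (suc r) = refl

pump-1 : ∀ {A : Set} (Y : ℕ → A) r → pump Y r 1 ≡ Y 1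
pump-1 Y zero    = refl
pump-1 Y (suc r) = refl

4*suc : ∀ r x → 4 * suc r + x ≡ 4 + (4 * r + x)
4*suc r x = trans (cong (_+ x) (ℕₚ.*-suc 4 r)) (ℕₚ.+-assoc 4 (4 * r) x)

pump-suffix : ∀ {A : Set} (Y : ℕ → A) r x → pump Y r (4 * r + x) ≡ Y x
pump-suffix Y zero    x = refl
pump-suffix Y (suc r) x = trans (cong (pump Y (suc r)) (4*suc r x)) (pump-suffix Y r x)

pump-interior : ∀ {A : Set} (R : A → A → Set) (Y : ℕ → A) {L} → 4 ≤ L →
  (∀ x → 2 + x < L → R (Y x) (Y (2 + x))) → R (Y 2) (Y 0) → R (Y 3) (Y 1) →
  ∀ r x → 2 + x < 4 * r + L → R (pump Y r x) (pump Y r (2 + x))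
pump-interior R Y L≥4 interior junction₂ junction₃ = go
  where
  go : ∀ r x → 2 + x < 4 * r + _ → R (pump Y r x) (pump Y r (2 + x))
  go zero    x lt = interior x lt
  go (suc r) 0 _  = interior 0 (ℕₚ.≤-trans (s≤s (s≤s (s≤s z≤n))) L≥4)
  go (suc r) 1 _  = interior 1 L≥4
  go (suc r) 2 _  = subst (R (Y 2)) (sym (pump-0 Y r)) junction₂
  go (suc r) 3 _  = subst (R (Y 3)) (sym (pump-1 Y r)) junction₃
  go (suc r) (suc (suc (suc (suc x)))) lt =
    go r x (ℕₚ.+-cancelˡ-< 4 _ _ (subst (6 + x <_) (4*suc r _) lt))

PumpableWord : ∀ {A : Set} → (A → A → Set) → (ℕ → A) → ℕ → Set
PumpableWord R Y L =
  (∀ (x : Fin (L ∸ 2)) → R (Y (toℕ x)) (Y (2 + toℕ x)))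
  × R (Y 2) (Y 0) × R (Y 3) (Y 1) × R (Y (L ∸ 1)) (Y 1) × R (Y (L ∸ 2)) (Y 0)

pumpableWord? : ∀ {A : Set} {R : A → A → Set} → Decidable R → ∀ Y L → Dec (PumpableWord R Y L)
pumpableWord? R? Y L =
  all? (λ x → R? _ _) ×-dec R? _ _ ×-dec R? _ _ ×-dec R? _ _ ×-dec R? _ _

-- Pumping inserts the block Y 0 … Y 3 before a copy of itself or of Y, and the junction
-- conditions say that this is harmless, so one finite check covers all lengths 4 r + L.
pump-dist2Hom : ∀ {A : Set} (R : A → A → Set) (Y : ℕ → A) {L} → 4 ≤ L → PumpableWord R Y L →
  ∀ r → Dist2Hom R (λ (i : Fin (4 * r + L)) → pump Y r (toℕ i))
pump-dist2Hom R Y {L} L≥4 (interior , junction₂ , junction₃ , wrap₁ , wrap₀) r =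
  dist2Hom-fromℕ R (pump Y r) (ℕₚ.≤-trans (ℕₚ.n≤1+n 3) (ℕₚ.≤-trans L≥4 (ℕₚ.m≤n+m L (4 * r))))
    (pump-interior R Y L≥4 interiorℕ junction₂ junction₃ r)
    (subst₂ R (sym (pump-from-end 1 (ℕₚ.≤-trans (s≤s z≤n) L≥4))) (sym (pump-1 Y r)) wrap₁)
    (subst₂ R (sym (pump-from-end 2 (ℕₚ.≤-trans (s≤s (s≤s z≤n)) L≥4))) (sym (pump-0 Y r)) wrap₀)
  where
  interiorℕ : ∀ x → 2 + x < L → R (Y x) (Y (2 + x))
  interiorℕ x lt = subst (λ z → R (Y z) (Y (2 + z))) (toℕ-fromℕ< x<L∸2) (interior (fromℕ< x<L∸2))
    where x<L∸2 = ℕₚ.∸-monoˡ-≤ 2 lt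
  pump-from-end : ∀ d → d ≤ L → pump Y r (4 * r + L ∸ d) ≡ Y (L ∸ d)
  pump-from-end d d≤L = trans (cong (pump Y r) (ℕₚ.+-∸-assoc (4 * r) d≤L)) (pump-suffix Y r (L ∸ d))

≢? : ∀ {k} → Decidable {A = Fin k} _≢_
≢? a b = ¬? (a Fin.≟ b)

distinct₄? : ∀ {k} (w x y z : Fin k) → Dec (Distinct₄ w x y z)
distinct₄? w x y z = ≢? w x ×-dec ≢? w y ×-dec ≢? w z ×-dec ≢? x y ×-dec ≢? x z ×-dec ≢? y z

cycSucc? : ∀ k → Decidable (CycSucc k)
cycSucc? k i j = (toℕ j ℕ.≟ suc (toℕ i)) ⊎-dec ((suc (toℕ i) ℕ.≟ k) ×-dec (toℕ j ℕ.≟ 0))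

adj? : ∀ k → Decidable (Adj (Cycle k))
adj? k i j = cycSucc? k i j ⊎-dec cycSucc? k j i

injective? : ∀ {p K} (x : Fin p → Fin K) → Dec (Injective _≡_ _≡_ x)
injective? x = map′ (λ h {a} {a′} → h a a′) (λ h a a′ → h)
  (all? λ a → all? λ a′ → (x a Fin.≟ x a′) →-dec (a Fin.≟ a′))

apart? : ∀ {p K} → Decidable (Apart {p} {K})
apart? x y = injective? x ×-dec injective? y ×-dec (all? λ a → all? λ a′ → ≢? (x a) (y a′))

cyclicWord : ∀ {A : Set} {L} .{{_ : ℕ.NonZero L}} → Vec A L → ℕ → A
cyclicWord {L = L} w x = lookup w (x mod L)

pumped-dist2Hom : ∀ {A : Set} {R : A → A → Set} (R? : Decidable R) {L} .{{_ : ℕ.NonZero L}}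
  (w : Vec A L) → 4 ≤ L → {True (pumpableWord? R? (cyclicWord w) L)} →
  ∀ {k} → (∃ λ r → k ≡ 4 * r + L) → Σ (Fin k → A) (Dist2Hom R)
pumped-dist2Hom {R = R} R? w L≥4 {ok} (r , refl) =
  (λ i → pump (cyclicWord w) r (toℕ i)) , pump-dist2Hom R (cyclicWord w) L≥4 (toWitness ok) r

multipleOf4⇒pumped : ∀ {k} → 3 ≤ k → 4 ∣ k → ∃ λ r → k ≡ 4 * r + 4
multipleOf4⇒pumped k≥3 (divides zero refl) = ⊥-elim (ℕₚ.<-irrefl refl (ℕₚ.≤-trans (s≤s z≤n) k≥3))
multipleOf4⇒pumped _ (divides (suc r) refl) = r , trans (ℕₚ.+-comm 4 (r * 4)) (cong (_+ 4) (ℕₚ.*-comm r 4))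

multipleOf4-dist2Hom : ∀ {k} → 3 ≤ k → 4 ∣ k → Σ (Fin k → Fin 2) (Dist2Hom _≢_)
multipleOf4-dist2Hom k≥3 4∣k =
  pumped-dist2Hom ≢? (# 0 ∷ # 0 ∷ # 1 ∷ # 1 ∷ []) ℕₚ.≤-refl (multipleOf4⇒pumped k≥3 4∣k)

threeOrSix-dist2Hom : ∀ {k} → k ≡ 3 ⊎ k ≡ 6 → Σ (Fin k → Fin 3) (Dist2Hom _≢_)
threeOrSix-dist2Hom (inj₁ refl) = (λ i → toℕ i mod 3) , toWitness {a? = all? λ i → ≢? _ _} _
threeOrSix-dist2Hom (inj₂ refl) = (λ i → toℕ i mod 3) , toWitness {a? = all? λ i → ≢? _ _} _

pumped-4-5-7-10 : ∀ k → 3 ≤ k → k ≢ 3 → k ≢ 6 →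
  ∃ λ r → k ≡ 4 * r + 4 ⊎ k ≡ 4 * r + 5 ⊎ k ≡ 4 * r + 7 ⊎ k ≡ 4 * r + 10
pumped-4-5-7-10 1  (s≤s ()) _ _
pumped-4-5-7-10 2  (s≤s (s≤s ())) _ _
pumped-4-5-7-10 3  _ k≢3 _ = ⊥-elim (k≢3 refl)
pumped-4-5-7-10 4  _ _ _   = 0 , inj₁ refl
pumped-4-5-7-10 5  _ _ _   = 0 , inj₂ (inj₁ refl)
pumped-4-5-7-10 6  _ _ k≢6 = ⊥-elim (k≢6 refl)
pumped-4-5-7-10 7  _ _ _   = 0 , inj₂ (inj₂ (inj₁ refl))
pumped-4-5-7-10 8  _ _ _   = 1 , inj₁ refl
pumped-4-5-7-10 9  _ _ _   = 1 , inj₂ (inj₁ refl)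
pumped-4-5-7-10 10 _ _ _   = 0 , inj₂ (inj₂ (inj₂ refl))
pumped-4-5-7-10 (suc (suc (suc (suc k@(suc (suc (suc (suc (suc (suc (suc _))))))))))) _ _ _
  with r , e ← pumped-4-5-7-10 k (s≤s (s≤s (s≤s z≤n))) (λ ()) (λ ()) =
  suc r , map (shift 4) (map (shift 5) (map (shift 7) (shift 10))) e
  where
  shift : ∀ L → k ≡ 4 * r + L → 4 + k ≡ 4 * suc r + L
  shift L e = trans (cong (4 +_) e) (sym (4*suc r L))

c5-dist2Hom : ∀ {k} → 3 ≤ k → k ≢ 3 × k ≢ 6 → Σ (Fin k → Fin 5) (Dist2Hom (Adj (Cycle 5)))
c5-dist2Hom {k} k≥3 (k≢3 , k≢6) with pumped-4-5-7-10 k k≥3 k≢3 k≢6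
... | r , inj₁ e = pumped-dist2Hom (adj? 5) (# 0 ∷ # 0 ∷ # 1 ∷ # 1 ∷ []) ℕₚ.≤-refl (r , e)
... | r , inj₂ (inj₁ e) =
  pumped-dist2Hom (adj? 5) (# 0 ∷ # 2 ∷ # 4 ∷ # 1 ∷ # 3 ∷ []) (ℕₚ.n≤1+n 4) (r , e)
... | r , inj₂ (inj₂ (inj₁ e)) =
  pumped-dist2Hom (adj? 5) (# 0 ∷ # 1 ∷ # 4 ∷ # 0 ∷ # 3 ∷ # 1 ∷ # 2 ∷ [])
    (s≤s (s≤s (s≤s (s≤s z≤n)))) (r , e)
... | r , inj₂ (inj₂ (inj₂ e)) =
  pumped-dist2Hom (adj? 5) (# 0 ∷ # 0 ∷ # 1 ∷ # 1 ∷ # 2 ∷ # 2 ∷ # 3 ∷ # 3 ∷ # 4 ∷ # 4 ∷ [])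
    (s≤s (s≤s (s≤s (s≤s z≤n)))) (r , e)

-- Colour a + 2 b: the four colours around a vertex differ by ±1, ±2 or ±1 ± 2, never by 0 modulo 5.
five-coloring : ∀ {m n} → 3 ≤ m → m ≢ 3 × m ≢ 6 → 3 ≤ n → n ≢ 3 × n ≢ 6 →
  InjColoring (Cycle m ×ᵍ Cycle n) 5
five-coloring m≥3 m∉3,6 n≥3 n∉3,6
  with α , α-hom ← c5-dist2Hom m≥3 m∉3,6 | β , β-hom ← c5-dist2Hom n≥3 n∉3,6 =
  _ , product-coloring (Adj (Cycle 5)) (Adj (Cycle 5)) φ spread α α-hom β β-hom
  where
  φ : Fin 5 → Fin 5 → Fin 5
  φ a b = (toℕ a + 2 * toℕ b) mod 5
  spread : ∀ {a₀ a₁ b₀ b₁} → Adj (Cycle 5) a₀ a₁ → Adj (Cycle 5) b₀ b₁ →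
    Distinct₄ (φ a₁ b₁) (φ a₁ b₀) (φ a₀ b₁) (φ a₀ b₀)
  spread {a₀} {a₁} {b₀} {b₁} = toWitness {a? = distinct?} _ a₀ a₁ b₀ b₁
    where
    distinct? = all? λ a₀ → all? λ a₁ → all? λ b₀ → all? λ b₁ →
      adj? 5 a₀ a₁ →-dec (adj? 5 b₀ b₁ →-dec
        distinct₄? (φ a₁ b₁) (φ a₁ b₀) (φ a₀ b₁) (φ a₀ b₀))

row : ∀ {A : Set} → A → A → A → Fin 3 → A
row a b c = lookup (a ∷ b ∷ c ∷ [])

odd-pumped-7-9 : ∀ t → 3 ≤ t → ∃ λ r → 2 * t + 1 ≡ 4 * r + 7 ⊎ 2 * t + 1 ≡ 4 * r + 9
odd-pumped-7-9 1 (s≤s ())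
odd-pumped-7-9 2 (s≤s (s≤s ()))
odd-pumped-7-9 3 _ = 0 , inj₁ refl
odd-pumped-7-9 4 _ = 0 , inj₂ refl
odd-pumped-7-9 (suc (suc t@(suc (suc (suc _))))) _
  with r , e ← odd-pumped-7-9 t (s≤s (s≤s (s≤s z≤n))) =
  suc r , map (shift 7) (shift 9) e
  where
  2*ss : 2 * suc (suc t) + 1 ≡ 4 + (2 * t + 1)
  2*ss = cong (_+ 1) (trans (ℕₚ.*-suc 2 (suc t)) (cong (2 +_) (ℕₚ.*-suc 2 t)))
  shift : ∀ L → 2 * t + 1 ≡ 4 * r + L → 2 * suc (suc t) + 1 ≡ 4 * suc r + L
  shift L e = trans 2*ss (trans (cong (4 +_) e) (sym (4*suc r L)))

-- Apart rows are disjoint 3-subsets of a 7-set: these words map the distance-two graph of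
-- C_{2t+1}, itself an odd cycle of length 2t + 1 ≥ 7, into the Kneser graph K(7,3).
odd-kneser-dist2Hom : ∀ t → 3 ≤ t → Σ (Fin (2 * t + 1) → Fin 3 → Fin 7) (Dist2Hom Apart)
odd-kneser-dist2Hom t t≥3 with odd-pumped-7-9 t t≥3
... | r , inj₁ e = pumped-dist2Hom apart? rows₇ (s≤s (s≤s (s≤s (s≤s z≤n)))) (r , e)
  where
  rows₇ : Vec (Fin 3 → Fin 7) 7
  rows₇ = row (# 0) (# 1) (# 2) ∷ row (# 0) (# 3) (# 4) ∷ row (# 3) (# 5) (# 6) ∷ row (# 1) (# 2) (# 5)
        ∷ row (# 0) (# 1) (# 4) ∷ row (# 3) (# 4) (# 6) ∷ row (# 2) (# 5) (# 6) ∷ []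
... | r , inj₂ e = pumped-dist2Hom apart? rows₉ (s≤s (s≤s (s≤s (s≤s z≤n)))) (r , e)
  where
  rows₉ : Vec (Fin 3 → Fin 7) 9
  rows₉ = row (# 0) (# 1) (# 2) ∷ row (# 0) (# 1) (# 3) ∷ row (# 3) (# 4) (# 5) ∷ row (# 2) (# 4) (# 5)
        ∷ row (# 0) (# 2) (# 6) ∷ row (# 0) (# 1) (# 3) ∷ row (# 1) (# 3) (# 4) ∷ row (# 4) (# 5) (# 6)
        ∷ row (# 2) (# 5) (# 6) ∷ []

c5-kneser-dist2Hom : Σ (Fin 5 → Fin 3 → Fin 8) (Dist2Hom Apart)
c5-kneser-dist2Hom = lookup rows₅ , toWitness {a? = all? λ i → apart? _ _} _
  where
  rows₅ : Vec (Fin 3 → Fin 8) 5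
  rows₅ = row (# 0) (# 1) (# 2) ∷ row (# 0) (# 1) (# 3) ∷ row (# 3) (# 4) (# 5) ∷ row (# 4) (# 5) (# 6)
        ∷ row (# 2) (# 6) (# 7) ∷ []

kneser-coloring : ∀ {m n K} → m ≡ 3 ⊎ m ≡ 6 → Σ (Fin n → Fin 3 → Fin K) (Dist2Hom Apart) →
  InjColoring (Cycle m ×ᵍ Cycle n) K
kneser-coloring m∈3,6 (β , β-hom) with α , α-hom ← threeOrSix-dist2Hom m∈3,6 =
  row-coloring α α-hom β β-hom

CommonNeighbour : (G : Graph) → V G → V G → Set
CommonNeighbour G u w = ∃ λ v → Adj G v u × Adj G v w

commonNeighbour-× : ∀ {G H : Graph} {a a′ b b′} → CommonNeighbour G a a′ → CommonNeighbour H b b′ →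
  CommonNeighbour (G ×ᵍ H) (a , b) (a′ , b′)
commonNeighbour-× (v , va , va′) (w , wb , wb′) = (v , w) , (va , wb) , (va′ , wb′)

injectiveColoring-separates : ∀ {G j f} → IsInjectiveColoring G j f →
  ∀ {u w} → CommonNeighbour G u w → f u ≡ f w → u ≡ w
injectiveColoring-separates f-inj (v , vu , vw) = f-inj v _ _ vu vw

ConflictClique : (G : Graph) {p : ℕ} → (Fin p → V G) → Set
ConflictClique G Q = Injective _≡_ _≡_ Q × (∀ x y → CommonNeighbour G (Q x) (Q y))

injectiveColoring-injective-on-clique : ∀ {G j f p} {Q : Fin p → V G} → IsInjectiveColoring G j f →
  ConflictClique G Q → Injective _≡_ _≡_ (f ∘ Q)
injectiveColoring-injective-on-clique f-inj (Q-inj , Q-cn) {x} {y} e =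
  Q-inj (injectiveColoring-separates f-inj (Q-cn x y) e)

clique-lowerBound : ∀ {G p} {Q : Fin p → V G} → ConflictClique G Q → ∀ {j} → InjColoring G j → p ≤ j
clique-lowerBound Q-clique (f , f-inj) = injective⇒≤ (injectiveColoring-injective-on-clique f-inj Q-clique)

remQuot-injective : ∀ {p} q → Injective _≡_ _≡_ (remQuot {p} q)
remQuot-injective {p} q {a} {b} e = begin
  a                          ≡⟨ sym (combine-remQuot {p} q a) ⟩
  uncurry combine (remQuot {p} q a) ≡⟨ cong (uncurry combine) e ⟩
  uncurry combine (remQuot {p} q b) ≡⟨ combine-remQuot {p} q b ⟩
  b                          ∎
  where open ≡-Reasoning

clique-× : ∀ {G H p q} {P : Fin p → V G} {Q : Fin q → V H} → ConflictClique G P → ConflictClique H Q →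
  ConflictClique (G ×ᵍ H) (λ a → P (proj₁ (remQuot {p} q a)) , Q (proj₂ (remQuot {p} q a)))
clique-× {G} {H} {p} {q} {P} {Q} (P-inj , P-cn) (Q-inj , Q-cn) =
    (λ e → let e₁ , e₂ = ,-injective e in remQuot-injective {p} q (×-≡,≡→≡ (P-inj e₁ , Q-inj e₂)))
  , λ a b → commonNeighbour-× {G} {H} (P-cn _ _) (Q-cn _ _)

pair : ∀ {A : Set} → A → A → Fin 2 → A
pair a b = lookup (a ∷ b ∷ [])

neighbours-clique : ∀ {k} → 3 ≤ k → (i : Fin k) → ConflictClique (Cycle k) (pair (prev i) (next i))
neighbours-clique {k} k≥3 i = injective , λ x y → i , adj x , adj y
  where
  adj : ∀ x → Adj (Cycle k) i (pair (prev i) (next i) x)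
  adj Fin.zero            = prev-adj i
  adj (Fin.suc Fin.zero)  = next-adj i
  injective : Injective _≡_ _≡_ (pair (prev i) (next i))
  injective {Fin.zero}           {Fin.zero}           _ = refl
  injective {Fin.zero}           {Fin.suc Fin.zero}   e = ⊥-elim (next≢prev k≥3 i (sym e))
  injective {Fin.suc Fin.zero}   {Fin.zero}           e = ⊥-elim (next≢prev k≥3 i e)
  injective {Fin.suc Fin.zero}   {Fin.suc Fin.zero}   _ = refl

commonNeighbour? : ∀ k → Decidable (CommonNeighbour (Cycle k))
commonNeighbour? k u w = any? λ v → adj? k v u ×-dec adj? k v w

conflictClique? : ∀ k {p} (Q : Fin p → Fin k) → Dec (ConflictClique (Cycle k) Q)
conflictClique? k Q = injective? Q ×-dec all? λ x → all? λ y → commonNeighbour? k (Q x) (Q y)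

threeOrSix-clique : ∀ {k} → k ≡ 3 ⊎ k ≡ 6 → Σ (Fin 3 → Fin k) (ConflictClique (Cycle k))
threeOrSix-clique (inj₁ refl) = row (# 0) (# 1) (# 2) , toWitness {a? = conflictClique? 3 _} _
threeOrSix-clique (inj₂ refl) = row (# 0) (# 2) (# 4) , toWitness {a? = conflictClique? 6 _} _

-- h has period 4, so the period n can be reduced to its residue ρ < 4, and ρ = 1, 2, 3 each
-- contradict the flips.
flipping-periodic⇒4∣ : (h : ℕ → Bool) → (∀ t → h (2 + t) ≡ not (h t)) →
  ∀ n → (∀ t → h (t + n) ≡ h t) → 4 ∣ n
flipping-periodic⇒4∣ h h-flip n h-period =
  from-residue (n % 4) (n / 4) (m%n<n n 4) (m≡m%n+[m/n]*n n 4)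
  where
  open ≡-Reasoning

  h-period₄ : ∀ q t → h (q * 4 + t) ≡ h t
  h-period₄ zero    t = refl
  h-period₄ (suc q) t = begin
    h (4 + (q * 4 + t))        ≡⟨ h-flip (2 + (q * 4 + t)) ⟩
    not (h (2 + (q * 4 + t)))  ≡⟨ cong not (h-flip (q * 4 + t)) ⟩
    not (not (h (q * 4 + t)))  ≡⟨ not-involutive _ ⟩
    h (q * 4 + t)              ≡⟨ h-period₄ q t ⟩
    h t                        ∎

  h-shift : ∀ ρ q → n ≡ ρ + q * 4 → ∀ t → h (t + ρ) ≡ h t
  h-shift ρ q n≡ t = begin
    h (t + ρ)                  ≡⟨ sym (h-period₄ q (t + ρ)) ⟩
    h (q * 4 + (t + ρ))        ≡⟨ cong h (ℕₚ.+-comm (q * 4) (t + ρ)) ⟩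
    h (t + ρ + q * 4)          ≡⟨ cong h (ℕₚ.+-assoc t ρ (q * 4)) ⟩
    h (t + (ρ + q * 4))        ≡⟨ cong (λ n → h (t + n)) (sym n≡) ⟩
    h (t + n)                  ≡⟨ h-period t ⟩
    h t                        ∎

  from-residue : ∀ ρ q → ρ < 4 → n ≡ ρ + q * 4 → 4 ∣ n
  from-residue 0 q _ n≡ = divides q n≡
  from-residue 1 q _ n≡ = ⊥-elim (not-¬ refl (begin
    h 0        ≡⟨ sym (h-shift 1 q n≡ 0) ⟩
    h 1        ≡⟨ sym (h-shift 1 q n≡ 1) ⟩
    h 2        ≡⟨ h-flip 0 ⟩
    not (h 0)  ∎))
  from-residue 2 q _ n≡ = ⊥-elim (not-¬ refl (trans (sym (h-shift 2 q n≡ 0)) (h-flip 0)))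
  from-residue 3 q _ n≡ = ⊥-elim (not-¬ refl (begin
    h 0        ≡⟨ sym (h-shift 3 q n≡ 0) ⟩
    h 3        ≡⟨ h-flip 1 ⟩
    not (h 1)  ≡⟨ cong not (sym (h-shift 3 q n≡ 1)) ⟩
    not (h 4)  ≡⟨ cong not (h-period₄ 1 0) ⟩
    not (h 0)  ∎))
  from-residue (suc (suc (suc (suc _)))) _ (s≤s (s≤s (s≤s (s≤s ())))) _

walk : ∀ {k} → ℕ → Fin (suc k)
walk zero    = Fin.zero
walk (suc t) = next (walk t)

toℕ-walk : ∀ {k} t → t < suc k → toℕ (walk {k} t) ≡ t
toℕ-walk zero    _  = refl
toℕ-walk {k} (suc t) lt = begin
  toℕ (next (walk t))            ≡⟨ toℕ-next (walk t) ⟩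
  sucMod (suc k) (toℕ (walk t))  ≡⟨ cong (sucMod (suc k)) (toℕ-walk t (ℕₚ.<-trans (ℕₚ.n<1+n t) lt)) ⟩
  sucMod (suc k) t               ≡⟨ sucMod-< lt ⟩
  suc t                          ∎
  where open ≡-Reasoning

walk-period : ∀ {k} t → walk {k} (t + suc k) ≡ walk t
walk-period {k} zero = toℕ-injective (begin
  toℕ (next (walk k))            ≡⟨ toℕ-next (walk k) ⟩
  sucMod (suc k) (toℕ (walk k))  ≡⟨ cong (sucMod (suc k)) (toℕ-walk k ℕₚ.≤-refl) ⟩
  sucMod (suc k) k               ≡⟨ sucMod-last k ⟩
  0                              ∎)
  where open ≡-Reasoning
walk-period (suc t) = cong next (walk-period t)

bipartite-dist2⇒4∣ : ∀ {k} (b : Fin (suc k) → Bool) → Dist2Hom _≢_ b → 4 ∣ suc k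
bipartite-dist2⇒4∣ b b-hom = flipping-periodic⇒4∣ (b ∘ walk) flips _ (λ t → cong b (walk-period t))
  where
  flips : ∀ t → b (walk (2 + t)) ≡ not (b (walk t))
  flips t = ¬-not (≢-sym (subst (λ v → b v ≢ b (walk (2 + t))) (prev-next (walk t)) (b-hom (walk (suc t)))))

does-true : ∀ {A : Set} (a? : Dec A) → does a? ≡ true → A
does-true (yes a) _ = a

exactlyOne⇒does≢ : ∀ {A B : Set} (a? : Dec A) (b? : Dec B) → (A → B → ⊥) → (¬ A → ¬ B → ⊥) →
  does a? ≢ does b?
exactlyOne⇒does≢ (yes a)  (yes b)  both _       = ⊥-elim (both a b)
exactlyOne⇒does≢ (yes _)  (no _)   _    _       = λ ()
exactlyOne⇒does≢ (no _)   (yes _)  _    _       = λ ()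
exactlyOne⇒does≢ (no ¬a)  (no ¬b)  _    neither = ⊥-elim (neither ¬a ¬b)

injective⇒surjective : ∀ {K} (h : Fin K → Fin K) → Injective _≡_ _≡_ h → ∀ c → ∃ λ a → h a ≡ c
injective⇒surjective {suc K} h h-inj c with any? (λ a → h a Fin.≟ c)
... | yes hit = hit
... | no miss = ⊥-elim (ℕₚ.<-irrefl refl (injective⇒≤ {f = λ a → punchOut (avoids a)}
                        (λ e → h-inj (punchOut-injective (avoids _) (avoids _) e))))
  where
  avoids : ∀ a → c ≢ h a
  avoids a e = miss (a , sym e)

-- With exactly 2p colours, a colour c occurs on the 2p-clique P × {j − 1, j + 1} exactly once:
-- at least once by counting, at most once because (P x , j − 1) and (P y , j + 1) share the
-- neighbour (v , j).  Hence "c occurs in column j" 2-colours the distance-two graph of C_n.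
tightColoring⇒4∣ : ∀ {m n p} {P : Fin (suc p) → Fin m} → ConflictClique (Cycle m) P → 3 ≤ n →
  InjColoring (Cycle m ×ᵍ Cycle n) (suc p * 2) → 4 ∣ n
tightColoring⇒4∣ {m} {suc n} {p} {P} P-clique n≥3 (f , f-inj) = bipartite-dist2⇒4∣ occurs occurs-flips
  where
  c : Fin (suc p * 2)
  c = Fin.zero

  OccursIn : Fin (suc n) → Set
  OccursIn j = ∃ λ x → f (P x , j) ≡ c

  occursIn? : ∀ j → Dec (OccursIn j)
  occursIn? j = any? λ x → f (P x , j) Fin.≟ c

  occurs : Fin (suc n) → Bool
  occurs j = does (occursIn? j)

  occurs-somewhere : ∀ j → OccursIn (prev j) ⊎ OccursIn (next j)
  occurs-somewhere j
    with a , fa≡c ← injective⇒surjective _ (injectiveColoring-injective-on-clique f-inj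
                      (clique-× {Cycle m} {Cycle (suc n)} P-clique (neighbours-clique n≥3 j))) c =
    column (proj₁ (remQuot {suc p} 2 a)) (proj₂ (remQuot {suc p} 2 a)) fa≡c
    where
    column : ∀ x z → f (P x , pair (prev j) (next j) z) ≡ c → OccursIn (prev j) ⊎ OccursIn (next j)
    column x Fin.zero            e = inj₁ (x , e)
    column x (Fin.suc Fin.zero)  e = inj₂ (x , e)

  occurs-once : ∀ j → OccursIn (prev j) → OccursIn (next j) → ⊥
  occurs-once j (x , fx) (y , fy) = next≢prev n≥3 j (sym (cong proj₂
    (injectiveColoring-separates f-inj
      (commonNeighbour-× {Cycle m} {Cycle (suc n)} (proj₂ P-clique x y) (j , prev-adj j , next-adj j))
      (trans fx (sym fy)))))

  occurs-flips : Dist2Hom _≢_ occurs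
  occurs-flips j = exactlyOne⇒does≢ (occursIn? (prev j)) (occursIn? (next j))
    (occurs-once j) (λ ∉₋ ∉₊ → [ ∉₋ , ∉₊ ] (occurs-somewhere j))

-- Labelling x by its colour and by whether that colour already occurs before x is injective.
fibres≤2⇒≤ : ∀ {N K} (f : Fin N → Fin K) →
  (∀ {x y z} → x Fin.< y → y Fin.< z → f x ≡ f y → f y ≡ f z → ⊥) → N ≤ K * 2
fibres≤2⇒≤ {N} {K} f no-triple = injective⇒≤ label-injective
  where
  EarlierWith : Fin N → Set
  EarlierWith x = ∃ λ y → y Fin.< x × f y ≡ f x

  earlierWith? : ∀ x → Dec (EarlierWith x)
  earlierWith? x = any? λ y → (y Fin.<? x) ×-dec (f y Fin.≟ f x)

  bit : Bool → Fin 2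
  bit false = Fin.zero
  bit true  = Fin.suc Fin.zero

  bit-injective : Injective _≡_ _≡_ bit
  bit-injective {false} {false} _ = refl
  bit-injective {true}  {true}  _ = refl

  label : Fin N → Fin (K * 2)
  label x = combine (f x) (bit (does (earlierWith? x)))

  ordered : ∀ {x x′} → x Fin.< x′ → f x ≡ f x′ →
    does (earlierWith? x) ≡ does (earlierWith? x′) → ⊥
  ordered {x} {x′} x<x′ e same
    with y , y<x , e′ ← does-true (earlierWith? x)
                          (trans same (dec-true (earlierWith? x′) (x , x<x′ , e))) =
    no-triple y<x x<x′ e′ e

  label-injective : Injective _≡_ _≡_ label
  label-injective {x} {x′} e with e₁ , e₂ ← combine-injective _ _ _ _ e with Finₚ.<-cmp x x′
  ... | tri< x<x′ _ _ = ⊥-elim (ordered x<x′ e₁ (bit-injective e₂))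
  ... | tri≈ _ x≡x′ _ = x≡x′
  ... | tri> _ _ x>x′ = ⊥-elim (ordered x>x′ (sym e₁) (sym (bit-injective e₂)))

c5-triples : ∀ {p₁ p₂ p₃} → p₁ ≢ p₂ → p₂ ≢ p₃ → p₁ ≢ p₃ →
  Adj (Cycle 5) p₁ p₂ ⊎ Adj (Cycle 5) p₁ p₃ ⊎ Adj (Cycle 5) p₂ p₃
c5-triples {p₁} {p₂} {p₃} = toWitness {a? = all? λ p₁ → all? λ p₂ → all? λ p₃ →
  ≢? p₁ p₂ →-dec ≢? p₂ p₃ →-dec ≢? p₁ p₃ →-dec
  (adj? 5 p₁ p₂ ⊎-dec adj? 5 p₁ p₃ ⊎-dec adj? 5 p₂ p₃)} _ p₁ p₂ p₃

-- A colour lies in at most two of the five disjoint-when-adjacent 3-sets, since any three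
-- vertices of C_5 contain two adjacent ones; but 5 · 3 > 7 · 2.
¬c5→kneser₇,₃ : (X : Fin 5 → Fin 3 → Fin 7) → ¬ (∀ {p q} → Adj (Cycle 5) p q → Apart (X p) (X q))
¬c5→kneser₇,₃ X X-hom = ℕₚ.<-irrefl refl (fibres≤2⇒≤ entry no-triple)
  where
  vertex : Fin (5 * 3) → Fin 5
  vertex a = proj₁ (remQuot {5} 3 a)

  entry : Fin (5 * 3) → Fin 7
  entry = uncurry X ∘ remQuot {5} 3

  distinct-vertices : ∀ {a b} → a ≢ b → entry a ≡ entry b → vertex a ≢ vertex b
  distinct-vertices {a} {b} a≢b e same-vertex = a≢b (remQuot-injective {5} 3 (×-≡,≡→≡
    (same-vertex , proj₁ (X-hom (next-adj (vertex b))) (subst (λ p → X p _ ≡ entry b) same-vertex e))))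

  disjoint : ∀ {p q} → Adj (Cycle 5) p q → ∀ r r′ → X p r ≢ X q r′
  disjoint a = proj₂ (proj₂ (X-hom a))

  no-triple : ∀ {a b c} → a Fin.< b → b Fin.< c → entry a ≡ entry b → entry b ≡ entry c → ⊥
  no-triple a<b b<c e₁ e₂
    with c5-triples (distinct-vertices (Finₚ.<⇒≢ a<b) e₁) (distinct-vertices (Finₚ.<⇒≢ b<c) e₂)
                    (distinct-vertices (Finₚ.<⇒≢ (Finₚ.<-trans a<b b<c)) (trans e₁ e₂))
  ... | inj₁ adj        = disjoint adj _ _ e₁
  ... | inj₂ (inj₁ adj) = disjoint adj _ _ (trans e₁ e₂)
  ... | inj₂ (inj₂ adj) = disjoint adj _ _ e₂

commonNeighbour-self : ∀ {k} (u : Fin k) → CommonNeighbour (Cycle k) u u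
commonNeighbour-self u = next u , swap (next-adj u) , swap (next-adj u)

-- Listing C_5 in the order 0, 2, 4, 1, 3 turns adjacent vertices into vertices at distance two.
c5-square : Fin 5 → Fin 5
c5-square = lookup (# 0 ∷ # 2 ∷ # 4 ∷ # 1 ∷ # 3 ∷ [])

c5-square-hom : ∀ {p q} → Adj (Cycle 5) p q →
  CommonNeighbour (Cycle 5) (c5-square p) (c5-square q) × c5-square p ≢ c5-square q
c5-square-hom {p} {q} = toWitness {a? = all? λ p → all? λ q → adj? 5 p q →-dec
  (commonNeighbour? 5 (c5-square p) (c5-square q) ×-dec ≢? (c5-square p) (c5-square q))} _ p q

no-seven-coloring : ∀ {m} → m ≡ 3 ⊎ m ≡ 6 → ¬ InjColoring (Cycle m ×ᵍ Cycle 5) 7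
no-seven-coloring {m} m∈3,6 (f , f-inj) with P , P-inj , P-cn ← threeOrSix-clique m∈3,6 =
  ¬c5→kneser₇,₃ X X-hom
  where
  X : Fin 5 → Fin 3 → Fin 7
  X p r = f (P r , c5-square p)

  separates : ∀ {r r′ p q} → CommonNeighbour (Cycle 5) (c5-square p) (c5-square q) →
    X p r ≡ X q r′ → P r ≡ P r′ × c5-square p ≡ c5-square q
  separates cn e =
    ,-injective (injectiveColoring-separates f-inj (commonNeighbour-× {Cycle m} {Cycle 5} (P-cn _ _) cn) e)

  X-injective : ∀ p → Injective _≡_ _≡_ (X p)
  X-injective p {r} {r′} e = P-inj (proj₁ (separates {r} {r′} {p} {p} (commonNeighbour-self (c5-square p)) e))

  X-hom : ∀ {p q} → Adj (Cycle 5) p q → Apart (X p) (X q)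
  X-hom {p} {q} a = X-injective p , X-injective q ,
    λ r r′ e → proj₂ (c5-square-hom a) (proj₂ (separates {r} {r′} {p} {q} (proj₁ (c5-square-hom a)) e))

injChromaticNumber : ∀ {G k} → InjColoring G k → (∀ {j} → InjColoring G j → k ≤ j) →
  InjChromaticNumber G k
injChromaticNumber coloring lower = coloring , λ j f f-inj → lower (f , f-inj)

lowerBound-suc : ∀ {G k} → (∀ {j} → InjColoring G j → k ≤ j) → ¬ InjColoring G k →
  ∀ {j} → InjColoring G j → suc k ≤ j
lowerBound-suc lower none coloring = ℕₚ.≤∧≢⇒< (lower coloring) λ { refl → none coloring }

edge-clique : ∀ {k} → 3 ≤ k → Σ (Fin 2 → Fin k) (ConflictClique (Cycle k))
edge-clique k≥3@(s≤s _) = _ , neighbours-clique k≥3 Fin.zero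

product-lowerBound : ∀ {m n p q} → Σ (Fin p → Fin m) (ConflictClique (Cycle m)) →
  Σ (Fin q → Fin n) (ConflictClique (Cycle n)) → ∀ {j} → InjColoring (Cycle m ×ᵍ Cycle n) j → p * q ≤ j
product-lowerBound {m} {n} (_ , P-clique) (_ , Q-clique) =
  clique-lowerBound (clique-× {Cycle m} {Cycle n} P-clique Q-clique)

odd⇒¬4∣ : ∀ {k} → ¬ 2 ∣ k → ¬ 4 ∣ k
odd⇒¬4∣ odd 4∣k = odd (∣-trans (divides 2 refl) 4∣k)

¬2∣2t+1 : ∀ t → ¬ 2 ∣ 2 * t + 1
¬2∣2t+1 t 2∣ with s≤s () ← ∣⇒≤ (∣m+n∣m⇒∣n 2∣ (divides t (ℕₚ.*-comm 2 t)))

¬4∣4t+2 : ∀ t → ¬ 4 ∣ 4 * t + 2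
¬4∣4t+2 t 4∣ with s≤s (s≤s ()) ← ∣⇒≤ (∣m+n∣m⇒∣n 4∣ (divides t (ℕₚ.*-comm 4 t)))

≥7⇒∉3,6 : ∀ {k} → 7 ≤ k → k ≢ 3 × k ≢ 6
≥7⇒∉3,6 k≥7 = ℕₚ.>⇒≢ (ℕₚ.≤-trans (s≤s (s≤s (s≤s (s≤s z≤n)))) k≥7) , ℕₚ.>⇒≢ k≥7

odd≥5⇒∉3,6 : ∀ {k} → ¬ 2 ∣ k → 5 ≤ k → k ≢ 3 × k ≢ 6
odd≥5⇒∉3,6 odd k≥5 =
  ℕₚ.>⇒≢ (ℕₚ.≤-trans (s≤s (s≤s (s≤s (s≤s z≤n)))) k≥5) , λ { refl → odd (divides 3 refl) }

4s+2≥7 : ∀ {s} → 2 ≤ s → 7 ≤ 4 * s + 2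
4s+2≥7 s≥2 = ℕₚ.≤-trans (ℕₚ.m≤n+m 7 3) (ℕₚ.+-monoˡ-≤ 2 (ℕₚ.*-monoʳ-≤ 4 s≥2))

case₂-conditions : ∀ {m n} →
    ((2 ∣ m × m ≢ 6 × ¬ (2 ∣ n) × 5 ≤ n)
      ⊎ (¬ (2 ∣ m) × ¬ (2 ∣ n) × 5 ≤ m × 5 ≤ n)
      ⊎ (∃[ s ] ∃[ t ] (2 ≤ s × 2 ≤ t × m ≡ 4 * s + 2 × n ≡ 4 * t + 2))
      ⊎ (m ≡ 4 × ∃[ t ] (2 ≤ t × n ≡ 4 * t + 2))) →
  (m ≢ 3 × m ≢ 6) × (n ≢ 3 × n ≢ 6) × ¬ 4 ∣ n
case₂-conditions (inj₁ (2∣m , m≢6 , odd-n , n≥5)) =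
  ((λ { refl → ¬2∣2t+1 1 2∣m }) , m≢6) , odd≥5⇒∉3,6 odd-n n≥5 , odd⇒¬4∣ odd-n
case₂-conditions (inj₂ (inj₁ (odd-m , odd-n , m≥5 , n≥5))) =
  odd≥5⇒∉3,6 odd-m m≥5 , odd≥5⇒∉3,6 odd-n n≥5 , odd⇒¬4∣ odd-n
case₂-conditions (inj₂ (inj₂ (inj₁ (s , t , s≥2 , t≥2 , refl , refl)))) =
  ≥7⇒∉3,6 (4s+2≥7 s≥2) , ≥7⇒∉3,6 (4s+2≥7 t≥2) , ¬4∣4t+2 t
case₂-conditions (inj₂ (inj₂ (inj₂ (refl , t , t≥2 , refl)))) =
  ((λ ()) , (λ ())) , ≥7⇒∉3,6 (4s+2≥7 t≥2) , ¬4∣4t+2 t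

χᵢ-4 : ∀ {m n} → 3 ≤ m → 3 ≤ n → 4 ∣ m → 4 ∣ n → InjChromaticNumber (Cycle m ×ᵍ Cycle n) 4
χᵢ-4 m≥3 n≥3 4∣m 4∣n = injChromaticNumber
  (grid-coloring (multipleOf4-dist2Hom m≥3 4∣m) (multipleOf4-dist2Hom n≥3 4∣n))
  (product-lowerBound (edge-clique m≥3) (edge-clique n≥3))

χᵢ-5 : ∀ {m n} → 3 ≤ m → 3 ≤ n → m ≢ 3 × m ≢ 6 → n ≢ 3 × n ≢ 6 → ¬ 4 ∣ n →
  InjChromaticNumber (Cycle m ×ᵍ Cycle n) 5
χᵢ-5 m≥3 n≥3 m∉3,6 n∉3,6 4∤n = injChromaticNumber
  (five-coloring m≥3 m∉3,6 n≥3 n∉3,6)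
  (lowerBound-suc (product-lowerBound (edge-clique m≥3) (edge-clique n≥3))
    (λ coloring → 4∤n (tightColoring⇒4∣ (proj₂ (edge-clique m≥3)) n≥3 coloring)))

χᵢ-6 : ∀ {m n} → 3 ≤ m → 4 ∣ m → n ≡ 3 ⊎ n ≡ 6 → InjChromaticNumber (Cycle m ×ᵍ Cycle n) 6
χᵢ-6 m≥3 4∣m n∈3,6 = injChromaticNumber
  (grid-coloring (multipleOf4-dist2Hom m≥3 4∣m) (threeOrSix-dist2Hom n∈3,6))
  (product-lowerBound (edge-clique m≥3) (threeOrSix-clique n∈3,6))

lowerBound-7 : ∀ {m n} → m ≡ 3 ⊎ m ≡ 6 → 3 ≤ n → ¬ 2 ∣ n →
  ∀ {j} → InjColoring (Cycle m ×ᵍ Cycle n) j → 7 ≤ j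
lowerBound-7 m∈3,6 n≥3 odd-n = lowerBound-suc
  (product-lowerBound (threeOrSix-clique m∈3,6) (edge-clique n≥3))
  (λ coloring → odd⇒¬4∣ odd-n (tightColoring⇒4∣ (proj₂ (threeOrSix-clique m∈3,6)) n≥3 coloring))

χᵢ-7 : ∀ {m n t} → m ≡ 3 ⊎ m ≡ 6 → 3 ≤ t → n ≡ 2 * t + 1 →
  InjChromaticNumber (Cycle m ×ᵍ Cycle n) 7
χᵢ-7 {t = t} m∈3,6 t≥3 refl = injChromaticNumber
  (kneser-coloring m∈3,6 (odd-kneser-dist2Hom t t≥3))
  (lowerBound-7 m∈3,6 (ℕₚ.≤-trans t≥3 (ℕₚ.≤-trans (ℕₚ.m≤m+n t _) (ℕₚ.m≤m+n _ 1))) (¬2∣2t+1 t))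

χᵢ-8 : ∀ {m n} → m ≡ 3 ⊎ m ≡ 6 → n ≡ 5 → InjChromaticNumber (Cycle m ×ᵍ Cycle n) 8
χᵢ-8 m∈3,6 refl = injChromaticNumber
  (kneser-coloring m∈3,6 c5-kneser-dist2Hom)
  (lowerBound-suc (lowerBound-7 m∈3,6 (s≤s (s≤s (s≤s z≤n))) (¬2∣2t+1 2)) (no-seven-coloring m∈3,6))

χᵢ-9 : ∀ {m n} → m ≡ 3 ⊎ m ≡ 6 → n ≡ 3 ⊎ n ≡ 6 → InjChromaticNumber (Cycle m ×ᵍ Cycle n) 9
χᵢ-9 m∈3,6 n∈3,6 = injChromaticNumber
  (grid-coloring (threeOrSix-dist2Hom m∈3,6) (threeOrSix-dist2Hom n∈3,6))
  (product-lowerBound (threeOrSix-clique m∈3,6) (threeOrSix-clique n∈3,6))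

theorem2p6 : ∀ (m n : ℕ) → (hm : 3 ≤ m) → (hn : 3 ≤ n) →
    ((4 ∣ m × 4 ∣ n) → InjChromaticNumber (Cycle m ×ᵍ Cycle n) 4)
  × (((2 ∣ m × m ≢ 6 × ¬ (2 ∣ n) × 5 ≤ n)
      ⊎ (¬ (2 ∣ m) × ¬ (2 ∣ n) × 5 ≤ m × 5 ≤ n)
      ⊎ (∃[ s ] ∃[ t ] (2 ≤ s × 2 ≤ t × m ≡ 4 * s + 2 × n ≡ 4 * t + 2))
      ⊎ (m ≡ 4 × ∃[ t ] (2 ≤ t × n ≡ 4 * t + 2)))
     → InjChromaticNumber (Cycle m ×ᵍ Cycle n) 5)
  × ((∃[ s ] (1 ≤ s × m ≡ 4 * s) × (n ≡ 3 ⊎ n ≡ 6))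
     → InjChromaticNumber (Cycle m ×ᵍ Cycle n) 6)
  × ((m ≡ 3 ⊎ m ≡ 6) × (∃[ t ] (3 ≤ t × n ≡ 2 * t + 1))
     → InjChromaticNumber (Cycle m ×ᵍ Cycle n) 7)
  × ((m ≡ 3 ⊎ m ≡ 6) × n ≡ 5
     → InjChromaticNumber (Cycle m ×ᵍ Cycle n) 8)
  × ((m ≡ 3 ⊎ m ≡ 6) × n ≡ 3
     → InjChromaticNumber (Cycle m ×ᵍ Cycle n) 9)
theorem2p6 m n hm hn =
    (λ (4∣m , 4∣n) → χᵢ-4 hm hn 4∣m 4∣n)
  , (λ conditions → let m∉3,6 , n∉3,6 , 4∤n = case₂-conditions conditions in
                     χᵢ-5 hm hn m∉3,6 n∉3,6 4∤n)
  , (λ (s , (_ , m≡4s) , n∈3,6) → χᵢ-6 hm (divides s (trans m≡4s (ℕₚ.*-comm 4 s))) n∈3,6)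
  , (λ (m∈3,6 , t , t≥3 , n≡2t+1) → χᵢ-7 m∈3,6 t≥3 n≡2t+1)
  , (λ (m∈3,6 , n≡5) → χᵢ-8 m∈3,6 n≡5)
  , (λ (m∈3,6 , n≡3) → χᵢ-9 m∈3,6 (inj₁ n≡3))
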